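{- Let $a_1, \ldots, a_k$ be positive integers, let $d = \gcd(a_1, \ldots, a_k)$, and suppose that not every positive integer is a non-negative integer linear combination of $a_1/d, \ldots, a_k/d$. Then, over the unary alphabet $\{{\tt 0}\}$, $$\mathrm{sc}(\{{\tt 0}^{a_1}, \ldots, {\tt 0}^{a_k}\}^*) = d\,\bigl(g(a_1/d, \ldots, a_k/d) + 1\bigr) + 1.$$
   Context: For a regular language $L$ over an alphabet $\Sigma$, $\mathrm{sc}(L)$ denotes the number of states of the minimal (complete) deterministic finite automaton over $\Sigma$ accepting $L$. For positive integers $b_1,\ldots,b_k$ with $\gcd 1$, $g(b_1,\ldots,b_k)$ is the largest positive integer that is not a non-negative integer linear combination of $b_1,\ldots,b_k$. -}

module Defs where

open import Data.Nat using (ℕ; zero; suc; _+_; _*_; _<_; _≤_)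
open import Data.Nat.GCD using (gcd)
open import Data.Fin using (Fin; zero; suc)
open import Data.Bool using (Bool; true)
open import Data.Unit using (⊤; tt)
open import Data.List using (List; []; _∷_; _++_; replicate; foldl)
open import Data.Product using (Σ; ∃; _×_; _,_)
open import Function using (_∘_)
open import Relation.Binary.PropositionalEquality using (_≡_)
open import Relation.Nullary using (¬_)

Language : Set → Set₁
Language A = List A → Set

data Star {A : Set} (L : Language A) : Language A where
  ε∈ : Star L []
  cat : ∀ {u v} → L u → Star L v → Star L (u ++ v)

record DFA (A : Set) (n : ℕ) : Set where
  field
    δ  : Fin n → A → Fin n
    q₀ : Fin n
    F  : Fin n → Bool

run : ∀ {A n} → DFA A n → Fin n → List A → Fin n
run D q w = foldl (DFA.δ D) q w

Accepts : ∀ {A n} → DFA A n → List A → Set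
Accepts D w = DFA.F D (run D (DFA.q₀ D) w) ≡ true

Recognizes : ∀ {A n} → DFA A n → Language A → Set
Recognizes D L = ∀ w → (L w → Accepts D w) × (Accepts D w → L w)

StateComplexity : ∀ {A} → Language A → ℕ → Set
StateComplexity {A} L m =
  (Σ (DFA A m) λ D → Recognizes D L) ×
  (∀ k → (D : DFA A k) → Recognizes D L → m ≤ k)

-- Unary alphabet {0}, represented by ⊤; 0^a = replicate a tt.
Unary : Set
Unary = ⊤

PowersLang : ∀ {k} → (Fin k → ℕ) → Language Unary
PowersLang {k} a w = ∃ λ (i : Fin k) → w ≡ replicate (a i) tt

sumFin : ∀ {k} → (Fin k → ℕ) → ℕ
sumFin {zero} f = 0
sumFin {suc k} f = f zero + sumFin (f ∘ suc)

gcdAll : ∀ {k} → (Fin k → ℕ) → ℕ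
gcdAll {zero} a = 0
gcdAll {suc k} a = gcd (a zero) (gcdAll (a ∘ suc))

Representable : ∀ {k} → (Fin k → ℕ) → ℕ → Set
Representable {k} b n = ∃ λ (c : Fin k → ℕ) → n ≡ sumFin (λ i → c i * b i)

IsFrobenius : ∀ {k} → (Fin k → ℕ) → ℕ → Set
IsFrobenius b f =
  0 < f × ¬ Representable b f × (∀ n → f < n → Representable b n)

-- Let d = gcd a and L = {n | 0ⁿ ∈ {0^{a₁}, …, 0^{a_k}}*}, the numerical semigroup generated
-- by the aᵢ. Every element of L is a multiple of d, every multiple of d beyond g·d lies in L,
-- and g·d does not. Membership in such a set is decided by an automaton with a tail
-- 0, 1, …, g·d followed by a cycle of length d, i.e. g·d + 1 + d states. Conversely, if two
-- of the words 0ˣ, 0ʸ with x < y < g·d + 1 + d were Myhill–Nerode equivalent, membership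
-- would be invariant under the shift p = y − x beyond x. Looking far out forces d ∣ p; then
-- either x ≤ g·d and the shift carries g·d into L, or x > g·d and 0 < p < d.
module Submission where

open import Data.Bool using (true)
open import Data.Empty using (⊥-elim)
open import Data.Fin using (Fin; zero; suc; toℕ; fromℕ<)
open import Data.Fin.Properties using (toℕ-fromℕ<; toℕ<n; toℕ-injective; injective⇒≤)
open import Data.List using (List; []; _∷_; _++_; replicate; length)
open import Data.List.Properties using (foldl-++; length-replicate)
open import Data.Nat
open import Data.Nat.DivMod using (m/n*n≡m)
open import Data.Nat.Divisibility using (_∣_; divides; ∣m∣n⇒∣m+n; ∣m+n∣m⇒∣n; ∣-trans; n∣m*n; ∣⇒≤)
open import Data.Nat.GCD using (gcd[m,n]∣m; gcd[m,n]∣n)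
open import Data.Nat.Properties
open import Algebra.Properties.CommutativeSemigroup +-commutativeSemigroup using (x∙yz≈y∙xz; xy∙z≈xz∙y)
open import Data.Nat.Tactic.RingSolver using (solve-∀)
open import Data.Product using (∃; _×_; _,_; proj₁; proj₂)
open import Data.Sum using (_⊎_; inj₁; inj₂; map₂)
open import Data.Unit using (⊤; tt)
open import Data.Vec.Functional using () renaming (_∷_ to _∷ᶠ_)
open import Defs
open import Function using (_∘_; case_of_; _⇔_; mk⇔; Equivalence)
open import Function.Properties.Equivalence using () renaming (refl to ⇔-refl; sym to ⇔-sym; trans to ⇔-trans)
open import Relation.Binary.Definitions using (tri<; tri≈; tri>)
open import Relation.Binary.PropositionalEquality
open import Relation.Nullary using (¬_; Dec; yes; no; does)
open import Relation.Nullary.Decidable using (map′; _×-dec_; dec-true)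
open import Relation.Unary using (Decidable)

open Equivalence using (to; from)

representable-∷ : ∀ {k} (a : Fin (suc k) → ℕ) m {n} →
                  Representable (a ∘ suc) n → Representable a (m * a zero + n)
representable-∷ a m (c , n≡) = m ∷ᶠ c , cong (m * a zero +_) n≡

representable-0 : ∀ {k} (a : Fin k → ℕ) → Representable a 0
representable-0 {zero}  a = (λ ()) , refl
representable-0 {suc k} a = representable-∷ a 0 (representable-0 (a ∘ suc))

representable-+ : ∀ {k} (a : Fin k → ℕ) i {n} → Representable a n → Representable a (a i + n)
representable-+ {suc k} a zero    (c , refl) = suc (c zero) ∷ᶠ c ∘ suc , sym (+-assoc (a zero) _ _)
representable-+ {suc k} a (suc i) (c , refl) =
  subst (Representable a) (x∙yz≈y∙xz (c zero * a zero) (a (suc i)) _)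
    (representable-∷ a (c zero) (representable-+ (a ∘ suc) i (c ∘ suc , refl)))

representable? : ∀ {k} (a : Fin k → ℕ) → (∀ i → 0 < a i) → Decidable (Representable a)
representable? {zero}  a _ zero    = yes ((λ ()) , refl)
representable? {zero}  a _ (suc n) = no λ { (_ , ()) }
representable? {suc k} a pos n =
  map′ fromWitness toWitness
    (anyUpTo? (λ m → (m * a zero ≤? n) ×-dec representable? (a ∘ suc) (pos ∘ suc) (n ∸ m * a zero))
              (suc n))
  where
  Witness : Set
  Witness = ∃ λ m → m < suc n × m * a zero ≤ n × Representable (a ∘ suc) (n ∸ m * a zero)

  fromWitness : Witness → Representable a n
  fromWitness (m , _ , m*a₀≤n , rest) =
    subst (Representable a) (m+[n∸m]≡n m*a₀≤n) (representable-∷ a m rest)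

  toWitness : Representable a n → Witness
  toWitness (c , refl) =
    c zero , s≤s (≤-trans (m≤m*n (c zero) (a zero) {{>-nonZero (pos zero)}}) (m≤m+n _ _)) ,
    m≤m+n _ _ , c ∘ suc , m+n∸m≡n (c zero * a zero) _

sumFin-scale : ∀ {k} {a b : Fin k → ℕ} {d} → (∀ i → a i ≡ b i * d) → (c : Fin k → ℕ) →
               sumFin (λ i → c i * a i) ≡ sumFin (λ i → c i * b i) * d
sumFin-scale {zero}  a≡b*d c = refl
sumFin-scale {suc k} {a} {b} {d} a≡b*d c = begin
  c zero * a zero + restᵃ            ≡⟨ cong₂ _+_ (cong (c zero *_) (a≡b*d zero)) rest-scale ⟩
  c zero * (b zero * d) + restᵇ * d  ≡⟨ cong (_+ restᵇ * d) (*-assoc (c zero) (b zero) d) ⟨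
  c zero * b zero * d + restᵇ * d    ≡⟨ *-distribʳ-+ d (c zero * b zero) restᵇ ⟨
  (c zero * b zero + restᵇ) * d      ∎
  where
  open ≡-Reasoning
  restᵃ restᵇ : ℕ
  restᵃ = sumFin (λ i → c (suc i) * a (suc i))
  restᵇ = sumFin (λ i → c (suc i) * b (suc i))
  rest-scale : restᵃ ≡ restᵇ * d
  rest-scale = sumFin-scale {a = a ∘ suc} {b ∘ suc} (a≡b*d ∘ suc) (c ∘ suc)

module _ {k} {a b : Fin k → ℕ} {d} (a≡b*d : ∀ i → a i ≡ b i * d) where

  representable⇒∣ : ∀ {n} → Representable a n → d ∣ n
  representable⇒∣ (c , refl) = divides (sumFin (λ i → c i * b i)) (sumFin-scale {a = a} {b} a≡b*d c)

  representable-*ʳ : ∀ {m} → Representable b m → Representable a (m * d)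
  representable-*ʳ (c , refl) = c , sym (sumFin-scale {a = a} {b} a≡b*d c)

  representable-*ʳ⁻¹ : .{{_ : NonZero d}} → ∀ {m} → Representable a (m * d) → Representable b m
  representable-*ʳ⁻¹ {m} (c , m*d≡) = c , *-cancelʳ-≡ m _ d (trans m*d≡ (sumFin-scale {a = a} {b} a≡b*d c))

gcdAll∣ : ∀ {k} (a : Fin k → ℕ) i → gcdAll a ∣ a i
gcdAll∣ {suc k} a zero    = gcd[m,n]∣m (a zero) _
gcdAll∣ {suc k} a (suc i) = ∣-trans (gcd[m,n]∣n (a zero) _) (gcdAll∣ (a ∘ suc) i)

length-replicate-++ : ∀ {A : Set} n {x : A} v → length (replicate n x ++ v) ≡ n + length v
length-replicate-++ zero    v = refl
length-replicate-++ (suc n) v = cong suc (length-replicate-++ n v)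

replicate-+ : ∀ {A : Set} m n {x : A} → replicate (m + n) x ≡ replicate m x ++ replicate n x
replicate-+ zero    n = refl
replicate-+ (suc m) n = cong (_ ∷_) (replicate-+ m n)

unary-η : (w : List ⊤) → w ≡ replicate (length w) tt
unary-η []      = refl
unary-η (_ ∷ w) = cong (tt ∷_) (unary-η w)

star-mono : ∀ {A : Set} {L L′ : Language A} → (∀ {w} → L w → L′ w) → ∀ {w} → Star L w → Star L′ w
star-mono L⊆L′ ε∈         = ε∈
star-mono L⊆L′ (cat u∈ s) = cat (L⊆L′ u∈) (star-mono L⊆L′ s)

star⇒representable : ∀ {k} (a : Fin k → ℕ) {w} → Star (PowersLang a) w → Representable a (length w)
star⇒representable a ε∈                         = representable-0 a
star⇒representable a (cat {v = v} (i , refl) s) =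
  subst (Representable a) (sym (length-replicate-++ (a i) v))
    (representable-+ a i (star⇒representable a s))

representable⇒star : ∀ {k} (a : Fin k → ℕ) {n} → Representable a n →
                     Star (PowersLang a) (replicate n tt)
representable⇒star {zero}  a (c , refl) = ε∈
representable⇒star {suc k} a (c , refl) = powers (c zero)
  where
  rest : ℕ
  rest = sumFin (λ i → c (suc i) * a (suc i))

  powers : ∀ m → Star (PowersLang a) (replicate (m * a zero + rest) tt)
  powers zero    = star-mono (λ { (i , w≡) → suc i , w≡ })
                     (representable⇒star (a ∘ suc) (c ∘ suc , refl))
  powers (suc m) = subst (Star (PowersLang a))
                     (sym (trans (cong (λ n → replicate n tt) (+-assoc (a zero) _ rest))
                                 (replicate-+ (a zero) _)))
                     (cat (zero , refl) (powers m))

star⇔representable : ∀ {k} (a : Fin k → ℕ) w → Star (PowersLang a) w ⇔ Representable a (length w)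
star⇔representable a w = mk⇔ (star⇒representable a)
  (subst (Star (PowersLang a)) (sym (unary-η w)) ∘ representable⇒star a)

recognizes-resp : ∀ {A n} {L L′ : Language A} {D : DFA A n} →
                  (∀ w → L w ⇔ L′ w) → Recognizes D L → Recognizes D L′
recognizes-resp L⇔L′ rec w = proj₁ (rec w) ∘ from (L⇔L′ w) , to (L⇔L′ w) ∘ proj₂ (rec w)

stateComplexity-resp : ∀ {A m} {L L′ : Language A} →
                       (∀ w → L w ⇔ L′ w) → StateComplexity L m → StateComplexity L′ m
stateComplexity-resp L⇔L′ ((D , rec) , minimal) =
  (D , recognizes-resp {D = D} L⇔L′ rec) ,
  λ k D′ rec′ → minimal k D′ (recognizes-resp {D = D′} (⇔-sym ∘ L⇔L′) rec′)

Indistinguishable : ∀ {A} → Language A → List A → List A → Set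
Indistinguishable L u v = ∀ t → L (u ++ t) ⇔ L (v ++ t)

module _ {A n} {L : Language A} {D : DFA A n} (rec : Recognizes D L) where

  open DFA D

  private
    accepts-++ : ∀ {u v} → run D q₀ u ≡ run D q₀ v → ∀ t → L (u ++ t) → L (v ++ t)
    accepts-++ {u} {v} same t u++t∈L = proj₂ (rec (v ++ t))
      (subst (λ q → F q ≡ true) run-u++t≡run-v++t (proj₁ (rec (u ++ t)) u++t∈L))
      where
      run-u++t≡run-v++t : run D q₀ (u ++ t) ≡ run D q₀ (v ++ t)
      run-u++t≡run-v++t = begin
        run D q₀ (u ++ t)       ≡⟨ foldl-++ δ q₀ u t ⟩
        run D (run D q₀ u) t    ≡⟨ cong (λ q → run D q t) same ⟩
        run D (run D q₀ v) t    ≡⟨ foldl-++ δ q₀ v t ⟨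
        run D q₀ (v ++ t)       ∎
        where open ≡-Reasoning

  same-state⇒indistinguishable : ∀ {u v} → run D q₀ u ≡ run D q₀ v → Indistinguishable L u v
  same-state⇒indistinguishable same t = mk⇔ (accepts-++ same t) (accepts-++ (sym same) t)

distinguishable⇒≤ : ∀ {A N K} {L : Language A} (w : Fin N → List A) →
                    (∀ {i j} → Indistinguishable L (w i) (w j) → i ≡ j) →
                    (D : DFA A K) → Recognizes D L → N ≤ K
distinguishable⇒≤ w distinguishable D rec =
  injective⇒≤ {f = run D (DFA.q₀ D) ∘ w} (distinguishable ∘ same-state⇒indistinguishable {D = D} rec)

indistinguishable-replicates : ∀ {P : ℕ → Set} {x y} →
  Indistinguishable (P ∘ length) (replicate x tt) (replicate y tt) → ∀ t → P (x + t) ⇔ P (y + t)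
indistinguishable-replicates {P} {x} {y} x≈y t =
  subst₂ (λ l r → P l ⇔ P r) (length-replicates x) (length-replicates y) (x≈y (replicate t tt))
  where
  length-replicates : ∀ z → length (replicate z tt ++ replicate t tt) ≡ z + t
  length-replicates z = trans (length-replicate-++ z (replicate t tt)) (cong (z +_) (length-replicate t))

does⇔ : ∀ {P : Set} (P? : Dec P) → does P? ≡ true ⇔ P
does⇔ P? = mk⇔ (witness P?) (dec-true P?)
  where
  witness : ∀ {P} (P? : Dec P) → does P? ≡ true → P
  witness (yes p) _ = p

module EventuallyMultiples {P : ℕ → Set} (P? : Decidable P) {c d : ℕ} .{{_ : NonZero d}}
  (d∣c : d ∣ c) (P⇒∣ : ∀ {n} → P n → d ∣ n) (∣⇒P : ∀ {n} → c < n → d ∣ n → P n) (¬Pc : ¬ P c)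
  where

  N : ℕ
  N = suc c + d

  -- n ⇝ q: reading 0ⁿ leads to state q, where the states c + 1, …, c + d form a cycle.
  infix 4 _⇝_
  _⇝_ : ℕ → ℕ → Set
  n ⇝ q = ∃ λ t → n ≡ q + t * d × (t ≡ 0 ⊎ c < q)

  ⇝-resp : ∀ {n q} → n ⇝ q → P n ⇔ P q
  ⇝-resp {q = q} (t , refl , inj₁ refl) =
    subst (λ m → P m ⇔ P q) (sym (+-identityʳ q)) ⇔-refl
  ⇝-resp {q = q} (t , refl , inj₂ c<q) = mk⇔
    (λ p → ∣⇒P c<q (∣m+n∣m⇒∣n (subst (d ∣_) (+-comm q (t * d)) (P⇒∣ p)) (n∣m*n t)))
    (λ p → ∣⇒P (<-≤-trans c<q (m≤m+n q (t * d))) (∣m∣n⇒∣m+n (P⇒∣ p) (n∣m*n t)))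

  c+1<N : suc c < N
  c+1<N = m<m+n (suc c) (>-nonZero⁻¹ d)

  step : Fin N → Fin N
  step q with suc (toℕ q) <? N
  ... | yes q+1<N = fromℕ< q+1<N
  ... | no  _     = fromℕ< c+1<N

  ⇝-step : ∀ {n} q → n ⇝ toℕ q → suc n ⇝ toℕ (step q)
  ⇝-step {n} q (t , n≡ , side) with suc (toℕ q) <? N
  ... | yes q+1<N = subst (suc n ⇝_) (sym (toℕ-fromℕ< q+1<N))
                     (t , cong suc n≡ , map₂ m<n⇒m<1+n side)
  ... | no  q+1≮N = subst (suc n ⇝_) (sym (toℕ-fromℕ< c+1<N)) (suc t , wraps , inj₂ (n<1+n c))
    where
    wraps : suc n ≡ suc c + suc t * d
    wraps = begin
      suc n                ≡⟨ cong suc n≡ ⟩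
      suc (toℕ q) + t * d  ≡⟨ cong (_+ t * d) (≤-antisym (toℕ<n q) (≮⇒≥ q+1≮N)) ⟩
      suc c + d + t * d    ≡⟨ +-assoc (suc c) d (t * d) ⟩
      suc c + suc t * d    ∎
      where open ≡-Reasoning

  automaton : DFA ⊤ N
  automaton = record { δ = λ q _ → step q ; q₀ = zero ; F = λ q → does (P? (toℕ q)) }

  run-⇝ : ∀ {m} q w → m ⇝ toℕ q → m + length w ⇝ toℕ (run automaton q w)
  run-⇝ {m} q []      m⇝q = subst (_⇝ toℕ q) (sym (+-identityʳ m)) m⇝q
  run-⇝ {m} q (_ ∷ w) m⇝q =
    subst (_⇝ toℕ (run automaton (step q) w)) (sym (+-suc m (length w))) (run-⇝ (step q) w (⇝-step q m⇝q))

  recognizes : Recognizes automaton (P ∘ length)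
  recognizes w = from accepts⇔ , to accepts⇔
    where
    accepts⇔ : Accepts automaton w ⇔ P (length w)
    accepts⇔ = ⇔-trans (does⇔ (P? (toℕ (run automaton zero w))))
                       (⇔-sym (⇝-resp (run-⇝ zero w (0 , refl , inj₁ refl))))

  shift-distinguishes : ∀ {x y} → x < y → y < N → ¬ (∀ t → P (x + t) ⇔ P (y + t))
  shift-distinguishes {x} {y} x<y y<N shift = case x ≤? c of λ where
      (yes x≤c) → ¬Pc (from (shift-by c x≤c) (∣⇒P (m<m+n c p>0) (∣m∣n⇒∣m+n d∣c d∣p)))
      (no  x≰c) → <⇒≱ (p<d x≰c) (∣⇒≤ {{>-nonZero p>0}} d∣p)
    where
    p : ℕ
    p = y ∸ x

    x+p≡y : x + p ≡ y
    x+p≡y = m+[n∸m]≡n (<⇒≤ x<y)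

    p>0 : 0 < p
    p>0 = m<n⇒0<n∸m x<y

    shift-by : ∀ n → x ≤ n → P n ⇔ P (n + p)
    shift-by n x≤n = subst₂ (λ l r → P l ⇔ P r) (m+[n∸m]≡n x≤n) y+t≡n+p (shift (n ∸ x))
      where
      y+t≡n+p : y + (n ∸ x) ≡ n + p
      y+t≡n+p = begin
        y + (n ∸ x)      ≡⟨ cong (_+ (n ∸ x)) x+p≡y ⟨
        x + p + (n ∸ x)  ≡⟨ xy∙z≈xz∙y x p (n ∸ x) ⟩
        x + (n ∸ x) + p  ≡⟨ cong (_+ p) (m+[n∸m]≡n x≤n) ⟩
        n + p            ∎
        where open ≡-Reasoning

    d∣p : d ∣ p
    d∣p = ∣m+n∣m⇒∣n (P⇒∣ (to (shift-by far x≤far) (∣⇒P c<far (n∣m*n (suc c + x)))))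
                    (n∣m*n (suc c + x))
      where
      far : ℕ
      far = (suc c + x) * d
      x≤far : x ≤ far
      x≤far = ≤-trans (m≤n+m x (suc c)) (m≤m*n _ d)
      c<far : c < far
      c<far = ≤-trans (m≤m+n (suc c) x) (m≤m*n _ d)

    p<d : ¬ x ≤ c → p < d
    p<d x≰c = +-cancelˡ-< x p d
      (<-≤-trans (subst (_< N) (sym x+p≡y) y<N) (+-monoˡ-≤ d (≰⇒> x≰c)))

  replicates-distinguishable : ∀ {i j : Fin N} →
    Indistinguishable (P ∘ length) (replicate (toℕ i) tt) (replicate (toℕ j) tt) → i ≡ j
  replicates-distinguishable {i} {j} i≈j with <-cmp (toℕ i) (toℕ j)
  ... | tri< i<j _ _ = ⊥-elim (shift-distinguishes i<j (toℕ<n j) (indistinguishable-replicates {P} i≈j))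
  ... | tri≈ _ i≡j _ = toℕ-injective i≡j
  ... | tri> _ _ j<i = ⊥-elim (shift-distinguishes j<i (toℕ<n i) (indistinguishable-replicates {P} (⇔-sym ∘ i≈j)))

  stateComplexity : StateComplexity (P ∘ length) N
  stateComplexity = (automaton , recognizes) ,
    λ K D rec → distinguishable⇒≤ (λ i → replicate (toℕ i) tt) replicates-distinguishable D rec

corollary4 : (k : ℕ) (a : Fin k → ℕ) → (∀ i → 0 < a i) →
    {{nz : NonZero (gcdAll a)}} →
    ¬ (∀ n → 0 < n → Representable (λ i → a i / gcdAll a) n) →
    (g : ℕ) → IsFrobenius (λ i → a i / gcdAll a) g →
    StateComplexity (Star (PowersLang a)) (gcdAll a * (g + 1) + 1)
corollary4 k a pos _ g (_ , g-unrepresentable , beyond-g-representable) =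
  subst (StateComplexity (Star (PowersLang a))) (count g d)
    (stateComplexity-resp (λ w → ⇔-sym (star⇔representable a w))
      (EventuallyMultiples.stateComplexity (representable? a pos) (n∣m*n g)
        (representable⇒∣ {b = λ i → a i / d} a≡b*d) beyond-g*d (g-unrepresentable ∘ representable-*ʳ⁻¹ a≡b*d)))
  where
  d : ℕ
  d = gcdAll a

  a≡b*d : ∀ i → a i ≡ a i / d * d
  a≡b*d i = sym (m/n*n≡m (gcdAll∣ a i))

  beyond-g*d : ∀ {n} → g * d < n → d ∣ n → Representable a n
  beyond-g*d g*d<q*d (divides q refl) =
    representable-*ʳ a≡b*d (beyond-g-representable q (*-cancelʳ-< d g q g*d<q*d))

  count : ∀ g d → suc (g * d) + d ≡ d * (g + 1) + 1
  count = solve-∀
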